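{- Let $\phi:\mathbb{P}(1,3)_{\mathbb{Q}}\to\mathbb{P}(4,6)_{\mathbb{Q}}$ be given by $\phi(a,b)=(a^4-4ab,\ -a^6+6a^3b-6b^2)$. Then the set $\mathcal{D}_\phi$ of discrepancy ideals equals $\{(1)\}$; that is, $\mathfrak{I}_{(4,6)}(\phi(x))=\mathfrak{I}_{(1,3)}(x)$ for all $x\in\mathbb{Q}^2-\{0\}$.
   Context: For a tuple $w=(w_1,\ldots,w_m)$ of positive integers and $y\in\mathbb{Q}^m-\{0\}$, the scaling ideal is $\mathfrak{I}_w(y)=\prod_p p^{\min_i\lfloor\mathrm{ord}_p(y_i)/w_i\rfloor}$, with $\mathrm{ord}_p0=\infty$. The morphism $\phi$ has $e=1$ (its components are homogeneous of degrees $4=1\cdot4$ and $6=1\cdot6$ when $a,b$ have degrees $1,3$), and $\mathcal{D}_\phi=\{\mathfrak{I}_{(4,6)}(\phi(x))\mathfrak{I}_{(1,3)}(x)^{ -1}:x\in\mathbb{Q}^2-\{0\}\}$. -}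

module Defs where

open import Data.Nat as ℕ using (ℕ; zero; suc; _%_; _/_; NonZero)
open import Data.Integer as ℤ using (ℤ; +_; _-_; _/ℕ_)
open import Data.Rational as ℚ using (ℚ; 0ℚ)
open import Data.Maybe using (Maybe; just; nothing)
open import Data.Vec using (Vec; []; _∷_)
open import Data.Product using (_×_; _,_)
open import Relation.Binary.PropositionalEquality using (_≡_)
open import Relation.Nullary using (¬_; yes; no)

-- p-adic valuation of a natural number n ≥ 1 (for p ≥ 2):
-- the largest k with p^k ∣ n.  Computed with fuel n, which suffices
-- since each step divides n by p ≥ 2.
vℕ-go : ℕ → (p : ℕ) → .{{NonZero p}} → ℕ → ℕ
vℕ-go zero    p n = 0
vℕ-go (suc f) p zero = 0
vℕ-go (suc f) p n@(suc _) with n % p ℕ.≟ 0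
... | yes _ = suc (vℕ-go f p (n / p))
... | no  _ = 0

vℕ : (p : ℕ) → .{{NonZero p}} → ℕ → ℕ
vℕ p n = vℕ-go n p n

-- ord_p on ℚ, with ord_p 0 = ∞ represented by 'nothing'.
-- For q = num/den in lowest terms (den ≥ 1), ord_p q = v_p |num| - v_p den.
ord : (p : ℕ) → .{{NonZero p}} → ℚ → Maybe ℤ
ord p q with ℚ.numerator q ℤ.≟ + 0
... | yes _ = nothing
... | no  _ = just (+ vℕ p ℤ.∣ ℚ.numerator q ∣ - + vℕ p (ℚ.denominatorℕ q))

-- ⌊ a / w ⌋ for a weight w ≥ 1 (floored division); ∞ / w = ∞.
-- (The weight-0 clause is junk and never used: all weights are positive.)
floorDiv : Maybe ℤ → ℕ → Maybe ℤ
floorDiv nothing  _       = nothing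
floorDiv (just a) zero    = just a
floorDiv (just a) (suc k) = just (a /ℕ suc k)

min∞ : Maybe ℤ → Maybe ℤ → Maybe ℤ
min∞ nothing  b        = b
min∞ (just a) nothing  = just a
min∞ (just a) (just b) = just (a ℤ.⊓ b)

-- Exponent of the prime p in the scaling ideal
--   𝔍_w(y) = ∏_p p^{min_i ⌊ord_p(y_i)/w_i⌋}.
-- A (nonzero) fractional ideal of ℤ is determined by its exponents at all
-- primes, so 𝔍_w(y) is represented by the map  p ↦ scalingExp w y p.
-- (Value 'nothing' = ∞ only occurs for y = 0, which is excluded.)
scalingExp : {m : ℕ} → Vec ℕ m → Vec ℚ m → (p : ℕ) → .{{NonZero p}} → Maybe ℤ
scalingExp []       []       p = nothing
scalingExp (w ∷ ws) (y ∷ ys) p = min∞ (floorDiv (ord p y) w) (scalingExp ws ys p)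

φ : ℚ → ℚ → Vec ℚ 2
φ a b = (a ℚ.* a ℚ.* a ℚ.* a ℚ.- (+ 4 ℚ./ 1) ℚ.* a ℚ.* b)
      ∷ (ℚ.- (a ℚ.* a ℚ.* a ℚ.* a ℚ.* a ℚ.* a)
           ℚ.+ (+ 6 ℚ./ 1) ℚ.* (a ℚ.* a ℚ.* a) ℚ.* b
           ℚ.- (+ 6 ℚ./ 1) ℚ.* (b ℚ.* b))
      ∷ []

{-# OPTIONS --safe #-}
-- Both sides are determined by their integer lower bounds: k ≤ min ⌊ord yᵢ / wᵢ⌋ iff wᵢ k ≤ ord yᵢ
-- for all i.  So it suffices that, for every k, (k ≤ ord a and 3k ≤ ord b) iff (4k ≤ ord φ₁ and
-- 6k ≤ ord φ₂).  The forward implication is the ultrametric inequality.  Conversely, suppose the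
-- bounds on (a, b) fail.  If ord a ≥ k, then ord b < 3k ≤ 3 ord a and, as ord 6 ≤ 1, the monomial
-- 6b² is the unique one of least valuation in φ₂, which is below 6k.  If v = ord a < k and
-- ord b > 3v, then a⁴ is the unique monomial of least valuation 4v < 4k in φ₁.  If ord b ≤ 3v, the
-- two terms of φ₁ may cancel; but φ₁ = a A′ with A′ = a³ − 4b, so 4k ≤ ord φ₁ makes ord A′ large,
-- and in φ₂ = 2b² − A′(A′ + 2b) the term 2b² dominates.
module Submission where

open import Defs
open import Data.Empty using (⊥-elim)
open import Data.Integer as ℤ using (ℤ; +_; -[1+_]; _/ℕ_; _%ℕ_)
open import Data.Integer.DivMod using (a≡a%ℕn+[a/ℕn]*n; n<s[n/ℕd]*d)
import Data.Integer.Divisibility.Signed as ℤ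
import Data.Integer.Properties as ℤ
open import Data.Integer.Tactic.RingSolver using (solve-∀)
open import Data.Maybe using (Maybe; just; nothing; map)
open import Data.Maybe.Properties using (just-injective)
open import Data.Nat as ℕ using (ℕ; zero; suc; _^_; _%_; _/_; NonZero; s≤s)
open import Data.Nat.DivMod using (m≡m%n+[m/n]*n; m/n<m)
open import Data.Nat.Divisibility
open import Data.Nat.Primality using (Prime; euclidsLemma; prime⇒nonZero; prime⇒nonTrivial)
import Data.Nat.Properties as ℕ
import Data.Nat.Tactic.RingSolver as ℕ-Solver
open import Data.Product using (_×_; _,_; proj₁; proj₂; ∃-syntax)
open import Data.Rational as ℚ using (ℚ; mkℚ; 0ℚ)
import Data.Rational.Properties as ℚ
open import Data.Rational.Solver using (module +-*-Solver)
open import Data.Rational.Unnormalised as ℚᵘ using (ℚᵘ; mkℚᵘ; *≡*; ↥_; ↧ₙ_)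
open import Data.Sum using (inj₁; inj₂)
open import Data.Unit using (⊤; tt)
open import Data.Vec using (Vec; []; _∷_)
open import Data.Vec.Relation.Binary.Pointwise.Inductive using (Pointwise; []; _∷_)
open import Data.Vec.Relation.Unary.All using (All; []; _∷_)
open import Function.Base using (_∘_)
open import Function.Bundles using (_⇔_; mk⇔; Equivalence)
open import Relation.Binary.PropositionalEquality
open import Relation.Nullary using (¬_; Dec; yes; no; contradiction)

-- Lower bounds in ℤ ∪ {∞}

infix 4 _≤∞_
infixl 6 _+∞_

_≤∞_ : ℤ → Maybe ℤ → Set
k ≤∞ nothing = ⊤
k ≤∞ just v  = k ℤ.≤ v

_+∞_ : Maybe ℤ → Maybe ℤ → Maybe ℤ
just x +∞ just y = just (x ℤ.+ y)
_      +∞ _      = nothing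

k+k+k≡3k : ∀ k → k ℤ.+ k ℤ.+ k ≡ + 3 ℤ.* k
k+k+k≡3k = solve-∀

i<suc[j]⇒i≤j : ∀ {i j} → i ℤ.< ℤ.suc j → i ℤ.≤ j
i<suc[j]⇒i≤j {j = j} i<1+j = subst (_ ℤ.≤_) (ℤ.pred-suc j) (ℤ.i<j⇒i≤pred[j] i<1+j)

suc[i]≰i : ∀ i → ¬ ℤ.suc i ℤ.≤ i
suc[i]≰i i 1+i≤i = ℤ.<-irrefl refl (ℤ.suc[i]≤j⇒i<j 1+i≤i)

≤∞-dec : ∀ k m → Dec (k ≤∞ m)
≤∞-dec k nothing  = yes tt
≤∞-dec k (just v) = k ℤ.≤? v

≤∞-trans : ∀ {j k} m → j ℤ.≤ k → k ≤∞ m → j ≤∞ m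
≤∞-trans nothing  _   _   = tt
≤∞-trans (just v) j≤k k≤v = ℤ.≤-trans j≤k k≤v

≤∞-+∞ : ∀ {k l} x y → k ≤∞ x → l ≤∞ y → k ℤ.+ l ≤∞ x +∞ y
≤∞-+∞ nothing  _        _   _   = tt
≤∞-+∞ (just _) nothing  _   _   = tt
≤∞-+∞ (just _) (just _) k≤x l≤y = ℤ.+-mono-≤ k≤x l≤y

≰∞⇒finite : ∀ {k} m → ¬ k ≤∞ m → ∃[ e ] m ≡ just e × e ℤ.< k
≰∞⇒finite nothing  k≰m = contradiction tt k≰m
≰∞⇒finite (just e) k≰e = e , refl , ℤ.≰⇒> k≰e

≤∞-exact : ∀ {e} m → e ≤∞ m → ¬ ℤ.suc e ≤∞ m → m ≡ just e
≤∞-exact nothing  _   e+1≰m = contradiction tt e+1≰m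
≤∞-exact (just v) e≤v e+1≰v = cong just (ℤ.≤-antisym (i<suc[j]⇒i≤j (ℤ.≰⇒> e+1≰v)) e≤v)

≤∞-shift : ∀ k c m → k ≤∞ map (ℤ._- c) m ⇔ k ℤ.+ c ≤∞ m
≤∞-shift k c nothing  = mk⇔ (λ _ → tt) (λ _ → tt)
≤∞-shift k c (just v) = mk⇔
  (λ k≤v-c → subst (k ℤ.+ c ℤ.≤_) (minus-plus v c) (ℤ.+-monoˡ-≤ c k≤v-c))
  (λ k+c≤v → subst (ℤ._≤ v ℤ.- c) (plus-minus k c) (ℤ.+-monoˡ-≤ (ℤ.- c) k+c≤v))
  where
  minus-plus : ∀ v c → v ℤ.- c ℤ.+ c ≡ v
  minus-plus = solve-∀
  plus-minus : ∀ k c → k ℤ.+ c ℤ.- c ≡ k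
  plus-minus = solve-∀

map-−-+∞ : ∀ c d x y → map (ℤ._- (c ℤ.+ d)) (x +∞ y) ≡ map (ℤ._- c) x +∞ map (ℤ._- d) y
map-−-+∞ c d nothing  _        = refl
map-−-+∞ c d (just _) nothing  = refl
map-−-+∞ c d (just a) (just b) = cong just (interchange a b c d)
  where
  interchange : ∀ a b c d → (a ℤ.+ b) ℤ.- (c ℤ.+ d) ≡ (a ℤ.- c) ℤ.+ (b ℤ.- d)
  interchange = solve-∀

+∞-just-cancel : ∀ c d x y → x +∞ just d ≡ y +∞ just c → map (ℤ._- c) x ≡ map (ℤ._- d) y
+∞-just-cancel c d nothing  nothing  _  = refl
+∞-just-cancel c d (just a) (just b) eq = cong just (begin
  a ℤ.- c                 ≡⟨ shift a c d ⟩
  (a ℤ.+ d) ℤ.- (d ℤ.+ c) ≡⟨ cong (ℤ._- (d ℤ.+ c)) (just-injective eq) ⟩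
  (b ℤ.+ c) ℤ.- (d ℤ.+ c) ≡⟨ unshift b c d ⟩
  b ℤ.- d                 ∎)
  where
  open ≡-Reasoning
  shift : ∀ a c d → a ℤ.- c ≡ (a ℤ.+ d) ℤ.- (d ℤ.+ c)
  shift = solve-∀
  unshift : ∀ b c d → (b ℤ.+ c) ℤ.- (d ℤ.+ c) ≡ b ℤ.- d
  unshift = solve-∀

≤∞-min : ∀ k x y → k ≤∞ min∞ x y ⇔ (k ≤∞ x × k ≤∞ y)
≤∞-min k nothing  y        = mk⇔ (tt ,_) proj₂
≤∞-min k (just a) nothing  = mk⇔ (_, tt) proj₁
≤∞-min k (just a) (just b) = mk⇔
  (λ k≤a⊓b → ℤ.≤-trans k≤a⊓b (ℤ.i⊓j≤i a b) , ℤ.≤-trans k≤a⊓b (ℤ.i⊓j≤j a b))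
  (λ (k≤a , k≤b) → ℤ.⊓-glb k≤a k≤b)

≤∞-ext : ∀ x y → (∀ k → k ≤∞ x ⇔ k ≤∞ y) → x ≡ y
≤∞-ext nothing  nothing  _ = refl
≤∞-ext nothing  (just b) x⇔y = ⊥-elim (suc[i]≰i b (Equivalence.to (x⇔y (ℤ.suc b)) tt))
≤∞-ext (just a) nothing  x⇔y = ⊥-elim (suc[i]≰i a (Equivalence.from (x⇔y (ℤ.suc a)) tt))
≤∞-ext (just a) (just b) x⇔y =
  cong just (ℤ.≤-antisym (Equivalence.to (x⇔y a) ℤ.≤-refl) (Equivalence.from (x⇔y b) ℤ.≤-refl))

≤/ℕ⇔*≤ : ∀ v w k .{{_ : NonZero w}} → k ℤ.≤ v /ℕ w ⇔ + w ℤ.* k ℤ.≤ v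
≤/ℕ⇔*≤ v w k = mk⇔ to from
  where
  open ℤ.≤-Reasoning
  q = v /ℕ w
  to : k ℤ.≤ q → + w ℤ.* k ℤ.≤ v
  to k≤q = begin
    + w ℤ.* k           ≤⟨ ℤ.*-monoˡ-≤-nonNeg (+ w) k≤q ⟩
    + w ℤ.* q           ≡⟨ ℤ.*-comm (+ w) q ⟩
    q ℤ.* + w           ≤⟨ ℤ.i≤j⇒i≤k+j (+ (v %ℕ w)) ℤ.≤-refl ⟩
    + (v %ℕ w) ℤ.+ q ℤ.* + w ≡⟨ a≡a%ℕn+[a/ℕn]*n v w ⟨
    v                   ∎
  from : + w ℤ.* k ℤ.≤ v → k ℤ.≤ q
  from wk≤v with k ℤ.≤? q
  ... | yes k≤q = k≤q
  ... | no  k≰q = contradiction (begin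
    ℤ.suc q ℤ.* + w     ≡⟨ ℤ.*-comm (ℤ.suc q) (+ w) ⟩
    + w ℤ.* ℤ.suc q     ≤⟨ ℤ.*-monoˡ-≤-nonNeg (+ w) (ℤ.i<j⇒suc[i]≤j (ℤ.≰⇒> k≰q)) ⟩
    + w ℤ.* k           ≤⟨ wk≤v ⟩
    v                   ∎) (ℤ.<⇒≱ (n<s[n/ℕd]*d v w))

≤∞-floorDiv : ∀ x w k → k ≤∞ floorDiv x (suc w) ⇔ + suc w ℤ.* k ≤∞ x
≤∞-floorDiv nothing  w k = mk⇔ (λ _ → tt) (λ _ → tt)
≤∞-floorDiv (just v) w k = ≤/ℕ⇔*≤ v (suc w) k

-- Scaling exponents

module _ (p : ℕ) .{{_ : NonZero p}} where

  ScaledBound : ℤ → ℕ → ℚ → Set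
  ScaledBound k w y = + w ℤ.* k ≤∞ ord p y

  ≤∞-scalingExp : ∀ {m} k (ws : Vec ℕ m) ys → All NonZero ws →
                  k ≤∞ scalingExp ws ys p ⇔ Pointwise (ScaledBound k) ws ys
  -- No clause for a weight 0 is needed: NonZero 0 is empty.
  ≤∞-scalingExp k []           []       []       = mk⇔ (λ _ → []) (λ _ → tt)
  ≤∞-scalingExp k (suc w ∷ ws) (y ∷ ys) (_ ∷ nz) = mk⇔
    (λ k≤s → let (k≤y , k≤ys) = to (≤∞-min k _ _) k≤s
             in to (≤∞-floorDiv (ord p y) w k) k≤y ∷ to (≤∞-scalingExp k ws ys nz) k≤ys)
    (λ { (k≤y ∷ k≤ys) → from (≤∞-min k _ _)
           (from (≤∞-floorDiv (ord p y) w k) k≤y , from (≤∞-scalingExp k ws ys nz) k≤ys) })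
    where open Equivalence

  scalingExp-cong : ∀ {m n} (ws : Vec ℕ m) ys (ws′ : Vec ℕ n) ys′ → All NonZero ws → All NonZero ws′ →
                    (∀ k → Pointwise (ScaledBound k) ws ys ⇔ Pointwise (ScaledBound k) ws′ ys′) →
                    scalingExp ws ys p ≡ scalingExp ws′ ys′ p
  scalingExp-cong ws ys ws′ ys′ nz nz′ bounds⇔ = ≤∞-ext _ _ λ k → mk⇔
    (from (≤∞-scalingExp k ws′ ys′ nz′) ∘ to (bounds⇔ k) ∘ to (≤∞-scalingExp k ws ys nz))
    (from (≤∞-scalingExp k ws ys nz) ∘ from (bounds⇔ k) ∘ to (≤∞-scalingExp k ws′ ys′ nz′))
    where open Equivalence

-- p-adic valuation of natural numbers

module _ {p : ℕ} .{{_ : NonZero p}} (1<p : 1 ℕ.< p) where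

  vℕ-go-spec : ∀ fuel n .{{_ : NonZero n}} → n ℕ.≤ fuel →
               p ^ vℕ-go fuel p n ∣ n × ¬ p ^ suc (vℕ-go fuel p n) ∣ n
  vℕ-go-spec (suc fuel) n@(suc _) (s≤s n≤1+fuel) with n % p ℕ.≟ 0
  ... | no  n%p≢0 = 1∣ n , λ p^1∣n → n%p≢0 (n∣m⇒m%n≡0 n p (subst (_∣ n) (ℕ.^-identityʳ p) p^1∣n))
  ... | yes n%p≡0 =
        subst (p ^ suc v ∣_) (sym n≡p*q) (*-monoʳ-∣ p p^v∣q)
      , λ p^2+v∣n → p^1+v∤q (*-cancelˡ-∣ p (subst (p ^ suc (suc v) ∣_) n≡p*q p^2+v∣n))
    where
    q = n / p
    v = vℕ-go fuel p q
    n≡p*q : n ≡ p ℕ.* q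
    n≡p*q = trans (m≡m%n+[m/n]*n n p) (trans (cong (ℕ._+ q ℕ.* p) n%p≡0) (ℕ.*-comm q p))
    instance
      q≢0 : NonZero q
      q≢0 = ℕ.m*n≢0⇒n≢0 p {{subst NonZero n≡p*q _}}
    q≤fuel : q ℕ.≤ fuel
    q≤fuel = ℕ.≤-trans (ℕ.≤-pred (m/n<m n p 1<p)) n≤1+fuel
    p^v∣q : p ^ v ∣ q
    p^v∣q = proj₁ (vℕ-go-spec fuel q q≤fuel)
    p^1+v∤q : ¬ p ^ suc v ∣ q
    p^1+v∤q = proj₂ (vℕ-go-spec fuel q q≤fuel)

  vℕ-spec : ∀ n .{{_ : NonZero n}} → p ^ vℕ p n ∣ n × ¬ p ^ suc (vℕ p n) ∣ n
  vℕ-spec n = vℕ-go-spec n n ℕ.≤-refl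

  ^-monoʳ-∣ : ∀ {i j} → i ℕ.≤ j → p ^ i ∣ p ^ j
  ^-monoʳ-∣ {i} i≤j with ℕ.m≤n⇒∃[o]m+o≡n i≤j
  ... | o , refl = divides (p ^ o) (trans (ℕ.^-distribˡ-+-* p i o) (ℕ.*-comm (p ^ i) (p ^ o)))

  ^∣⇔≤vℕ : ∀ {k} n .{{_ : NonZero n}} → p ^ k ∣ n ⇔ k ℕ.≤ vℕ p n
  ^∣⇔≤vℕ {k} n = mk⇔ to (λ k≤v → ∣-trans (^-monoʳ-∣ k≤v) (proj₁ (vℕ-spec n)))
    where
    to : p ^ k ∣ n → k ℕ.≤ vℕ p n
    to p^k∣n with k ℕ.≤? vℕ p n
    ... | yes k≤v = k≤v
    ... | no  k≰v = contradiction (∣-trans (^-monoʳ-∣ (ℕ.≰⇒> k≰v)) p^k∣n) (proj₂ (vℕ-spec n))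

  vℕ-unique : ∀ {k} n .{{_ : NonZero n}} → p ^ k ∣ n → ¬ p ^ suc k ∣ n → vℕ p n ≡ k
  vℕ-unique {k} n p^k∣n p^1+k∤n = ℕ.≤-antisym v≤k (Equivalence.to (^∣⇔≤vℕ n) p^k∣n)
    where
    v≤k : vℕ p n ℕ.≤ k
    v≤k with vℕ p n ℕ.≤? k
    ... | yes v≤k = v≤k
    ... | no  v≰k = contradiction (Equivalence.from (^∣⇔≤vℕ n) (ℕ.≰⇒> v≰k)) p^1+k∤n

  vℕ-≡0 : ∀ n .{{_ : NonZero n}} → ¬ p ∣ n → vℕ p n ≡ 0
  vℕ-≡0 n p∤n = vℕ-unique n (1∣ n) λ p^1∣n → p∤n (subst (_∣ n) (ℕ.^-identityʳ p) p^1∣n)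

  vℕ-1 : vℕ p 1 ≡ 0
  vℕ-1 = vℕ-≡0 1 (λ p∣1 → ℕ.<⇒≢ 1<p (sym (∣1⇒≡1 p∣1)))

  vℕ-≤1 : ∀ n .{{_ : NonZero n}} → ¬ p ^ 2 ∣ n → vℕ p n ℕ.≤ 1
  vℕ-≤1 n p²∤n = ℕ.≤-pred (ℕ.≰⇒> (p²∤n ∘ Equivalence.from (^∣⇔≤vℕ n)))

  private
    4∤6 : ¬ 4 ∣ 6
    4∤6 (divides (suc (suc _)) ())

  p²∤6 : ¬ p ^ 2 ∣ 6
  p²∤6 p²∣6 with p ℕ.≟ 2
  ... | yes p≡2 = 4∤6 (subst (λ q → q ^ 2 ∣ 6) p≡2 p²∣6)
  ... | no  p≢2  = ℕ.<⇒≱ (ℕ.≤-trans (ℕ.m≤m+n 7 2) 9≤p²) (∣⇒≤ p²∣6)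
    where
    3≤p : 3 ℕ.≤ p
    3≤p = ℕ.≤∧≢⇒< 1<p (p≢2 ∘ sym)
    9≤p² : 9 ℕ.≤ p ^ 2
    9≤p² = ℕ.*-mono-≤ 3≤p (subst (3 ℕ.≤_) (sym (ℕ.*-identityʳ p)) 3≤p)

  p²∤2 : ¬ p ^ 2 ∣ 2
  p²∤2 p²∣2 = p²∤6 (∣-trans p²∣2 (divides 3 refl))

-- p-adic valuation of rationals

module _ {p : ℕ} (prime : Prime p) where

  private instance
    p≢0 : NonZero p
    p≢0 = prime⇒nonZero prime

  1<p : 1 ℕ.< p
  1<p = ℕ.nonTrivial⇒n>1 p {{prime⇒nonTrivial prime}}

  vℕ-* : ∀ m n .{{_ : NonZero m}} .{{_ : NonZero n}} → vℕ p (m ℕ.* n) ≡ vℕ p m ℕ.+ vℕ p n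
  vℕ-* m n with vℕ-spec 1<p m | vℕ-spec 1<p n
  ... | divides m′ m≡m′p^a , p^1+a∤m | divides n′ n≡n′p^b , p^1+b∤n =
    vℕ-unique 1<p (m ℕ.* n) {{ℕ.m*n≢0 m n}} p^a+b∣mn p^1+a+b∤mn
    where
    a = vℕ p m
    b = vℕ p n
    interchange : ∀ w x y z → (w ℕ.* y) ℕ.* (x ℕ.* z) ≡ (y ℕ.* z) ℕ.* (w ℕ.* x)
    interchange = ℕ-Solver.solve-∀
    mn≡ : m ℕ.* n ≡ p ^ (a ℕ.+ b) ℕ.* (m′ ℕ.* n′)
    mn≡ = trans (cong₂ ℕ._*_ m≡m′p^a n≡n′p^b)
            (trans (interchange m′ n′ (p ^ a) (p ^ b))
                   (cong (ℕ._* (m′ ℕ.* n′)) (sym (ℕ.^-distribˡ-+-* p a b))))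
    p^a+b∣mn : p ^ (a ℕ.+ b) ∣ m ℕ.* n
    p^a+b∣mn = divides (m′ ℕ.* n′) (trans mn≡ (ℕ.*-comm (p ^ (a ℕ.+ b)) (m′ ℕ.* n′)))
    p∣m′n′ : p ^ suc (a ℕ.+ b) ∣ m ℕ.* n → p ∣ m′ ℕ.* n′
    p∣m′n′ p^1+a+b∣mn = *-cancelˡ-∣ (p ^ (a ℕ.+ b)) {{ℕ.m^n≢0 p (a ℕ.+ b)}}
                          (subst₂ _∣_ (ℕ.*-comm p (p ^ (a ℕ.+ b))) mn≡ p^1+a+b∣mn)
    p∤cofactor : ∀ {c x} k → x ≡ c ℕ.* p ^ k → ¬ p ^ suc k ∣ x → ¬ p ∣ c
    p∤cofactor k refl p^1+k∤x p∣c = p^1+k∤x (*-monoˡ-∣ (p ^ k) p∣c)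
    p^1+a+b∤mn : ¬ p ^ suc (a ℕ.+ b) ∣ m ℕ.* n
    p^1+a+b∤mn p^1+a+b∣mn with euclidsLemma m′ n′ prime (p∣m′n′ p^1+a+b∣mn)
    ... | inj₁ p∣m′ = p∤cofactor a m≡m′p^a p^1+a∤m p∣m′
    ... | inj₂ p∣n′ = p∤cofactor b n≡n′p^b p^1+b∤n p∣n′

  ordℕ : ℕ → Maybe ℤ
  ordℕ zero      = nothing
  ordℕ n@(suc _) = just (+ vℕ p n)

  ordℤ : ℤ → Maybe ℤ
  ordℤ z = ordℕ ℤ.∣ z ∣

  ordℕ-* : ∀ m n → ordℕ (m ℕ.* n) ≡ ordℕ m +∞ ordℕ n
  ordℕ-* zero      n         = refl
  ordℕ-* (suc m)   zero      = cong ordℕ (ℕ.*-zeroʳ m)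
  ordℕ-* m@(suc _) n@(suc _) = cong (just ∘ +_) (vℕ-* m n)

  ordℤ-* : ∀ z w → ordℤ (z ℤ.* w) ≡ ordℤ z +∞ ordℤ w
  ordℤ-* z w = trans (cong ordℕ (ℤ.abs-* z w)) (ordℕ-* ℤ.∣ z ∣ ℤ.∣ w ∣)

  ordℤ-neg : ∀ z → ordℤ (ℤ.- z) ≡ ordℤ z
  ordℤ-neg z = cong ordℕ (ℤ.∣-i∣≡∣i∣ z)

  0≤∞ordℕ : ∀ n → + 0 ≤∞ ordℕ n
  0≤∞ordℕ zero    = tt
  0≤∞ordℕ (suc n) = ℤ.+≤+ ℕ.z≤n

  ≤∞ordℕ⇔^∣ : ∀ j n → + j ≤∞ ordℕ n ⇔ p ^ j ∣ n
  ≤∞ordℕ⇔^∣ j zero    = mk⇔ (λ _ → (p ^ j) ∣0) (λ _ → tt)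
  ≤∞ordℕ⇔^∣ j n@(suc _) =
    mk⇔ (from (^∣⇔≤vℕ 1<p n) ∘ ℤ.drop‿+≤+) (ℤ.+≤+ ∘ to (^∣⇔≤vℕ 1<p n))
    where open Equivalence

  ordℤ-+ : ∀ {k} z w → k ≤∞ ordℤ z → k ≤∞ ordℤ w → k ≤∞ ordℤ (z ℤ.+ w)
  ordℤ-+ { -[1+ _ ]} z w _ _ = ≤∞-trans (ordℤ (z ℤ.+ w)) ℤ.-≤+ (0≤∞ordℕ ℤ.∣ z ℤ.+ w ∣)
  ordℤ-+ {+ j} z w j≤z j≤w =
    from (≤∞ordℕ⇔^∣ j _)
      (ℤ.∣⇒∣ᵤ {+ p ^ j} {z ℤ.+ w} (ℤ.∣m∣n⇒∣m+n (p^j∣ z j≤z) (p^j∣ w j≤w)))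
    where
    open Equivalence
    p^j∣ : ∀ x → + j ≤∞ ordℤ x → (+ p ^ j) ℤ.∣ x
    p^j∣ x j≤x = ℤ.∣ᵤ⇒∣ {+ p ^ j} {x} (to (≤∞ordℕ⇔^∣ j ℤ.∣ x ∣) j≤x)

  ordᵘ : ℚᵘ → Maybe ℤ
  ordᵘ x = map (ℤ._- + vℕ p (↧ₙ x)) (ordℤ (↥ x))

  ordᵘ-cong : ∀ {x y} → x ℚᵘ.≃ y → ordᵘ x ≡ ordᵘ y
  ordᵘ-cong {mkℚᵘ m _} {mkℚᵘ n _} (*≡* eq) =
    +∞-just-cancel _ _ (ordℤ m) (ordℤ n) (trans (sym (ordℤ-* m _)) (trans (cong ordℤ eq) (ordℤ-* n _)))

  ordᵘ-* : ∀ x y → ordᵘ (x ℚᵘ.* y) ≡ ordᵘ x +∞ ordᵘ y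
  ordᵘ-* (mkℚᵘ m c) (mkℚᵘ n d) = begin
    map (ℤ._- + vℕ p (suc c ℕ.* suc d)) (ordℤ (m ℤ.* n))
      ≡⟨ cong₂ (λ v o → map (ℤ._- + v) o) (vℕ-* (suc c) (suc d)) (ordℤ-* m n) ⟩
    map (ℤ._- (+ vℕ p (suc c) ℤ.+ + vℕ p (suc d))) (ordℤ m +∞ ordℤ n)
      ≡⟨ map-−-+∞ _ _ (ordℤ m) (ordℤ n) ⟩
    ordᵘ (mkℚᵘ m c) +∞ ordᵘ (mkℚᵘ n d) ∎
    where open ≡-Reasoning

  ordᵘ-neg : ∀ x → ordᵘ (ℚᵘ.- x) ≡ ordᵘ x
  ordᵘ-neg (mkℚᵘ n d) = cong (map (ℤ._- + vℕ p (suc d))) (ordℤ-neg n)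

  ordᵘ-+ : ∀ {k} x y → k ≤∞ ordᵘ x → k ≤∞ ordᵘ y → k ≤∞ ordᵘ (x ℚᵘ.+ y)
  ordᵘ-+ {k} (mkℚᵘ m c) (mkℚᵘ n d) k≤x k≤y =
    from (≤∞-shift k _ (ordℤ S)) (subst (λ v → k ℤ.+ + v ≤∞ ordℤ S) (sym (vℕ-* (suc c) (suc d)))
      (ordℤ-+ (m ℤ.* + suc d) (n ℤ.* + suc c)
        (subst (_≤∞ _) (ℤ.+-assoc k vc vd) (≤∞-cross m d vc k≤x))
        (subst (_≤∞ _) (rearrange k vc vd) (≤∞-cross n c vd k≤y))))
    where
    open Equivalence
    S = m ℤ.* + suc d ℤ.+ n ℤ.* + suc c
    vc = + vℕ p (suc c)
    vd = + vℕ p (suc d)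
    ≤∞-cross : ∀ z e u → k ≤∞ map (ℤ._- u) (ordℤ z) →
               k ℤ.+ u ℤ.+ + vℕ p (suc e) ≤∞ ordℤ (z ℤ.* + suc e)
    ≤∞-cross z e u k≤z = subst (_ ≤∞_) (sym (ordℤ-* z (+ suc e)))
      (≤∞-+∞ (ordℤ z) (ordℤ (+ suc e)) (to (≤∞-shift k u (ordℤ z)) k≤z) ℤ.≤-refl)
    rearrange : ∀ k u w → k ℤ.+ w ℤ.+ u ≡ k ℤ.+ (u ℤ.+ w)
    rearrange = solve-∀

  ord-toℚᵘ : ∀ q → ord p q ≡ ordᵘ (ℚ.toℚᵘ q)
  ord-toℚᵘ (mkℚ (+ zero)   _ _) = refl
  ord-toℚᵘ (mkℚ (+ suc _)  _ _) = refl
  ord-toℚᵘ (mkℚ -[1+ _ ]   _ _) = refl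

  ord-* : ∀ x y → ord p (x ℚ.* y) ≡ ord p x +∞ ord p y
  ord-* x y = begin
    ord p (x ℚ.* y)                      ≡⟨ ord-toℚᵘ (x ℚ.* y) ⟩
    ordᵘ (ℚ.toℚᵘ (x ℚ.* y))              ≡⟨ ordᵘ-cong (ℚ.toℚᵘ-homo-* x y) ⟩
    ordᵘ (ℚ.toℚᵘ x ℚᵘ.* ℚ.toℚᵘ y)        ≡⟨ ordᵘ-* (ℚ.toℚᵘ x) (ℚ.toℚᵘ y) ⟩
    ordᵘ (ℚ.toℚᵘ x) +∞ ordᵘ (ℚ.toℚᵘ y)   ≡⟨ cong₂ _+∞_ (ord-toℚᵘ x) (ord-toℚᵘ y) ⟨
    ord p x +∞ ord p y                   ∎
    where open ≡-Reasoning

  ord-neg : ∀ x → ord p (ℚ.- x) ≡ ord p x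
  ord-neg x = begin
    ord p (ℚ.- x)              ≡⟨ ord-toℚᵘ (ℚ.- x) ⟩
    ordᵘ (ℚ.toℚᵘ (ℚ.- x))      ≡⟨ ordᵘ-cong (ℚ.toℚᵘ-homo‿- x) ⟩
    ordᵘ (ℚᵘ.- ℚ.toℚᵘ x)       ≡⟨ ordᵘ-neg (ℚ.toℚᵘ x) ⟩
    ordᵘ (ℚ.toℚᵘ x)            ≡⟨ ord-toℚᵘ x ⟨
    ord p x                    ∎
    where open ≡-Reasoning

  ord-+ : ∀ {k} x y → k ≤∞ ord p x → k ≤∞ ord p y → k ≤∞ ord p (x ℚ.+ y)
  ord-+ {k} x y k≤x k≤y =
    subst (k ≤∞_) (sym (trans (ord-toℚᵘ (x ℚ.+ y)) (ordᵘ-cong (ℚ.toℚᵘ-homo-+ x y))))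
      (ordᵘ-+ (ℚ.toℚᵘ x) (ℚ.toℚᵘ y)
        (subst (k ≤∞_) (ord-toℚᵘ x) k≤x) (subst (k ≤∞_) (ord-toℚᵘ y) k≤y))

  ord-just⇒≤∞ : ∀ {e} x → ord p x ≡ just e → e ≤∞ ord p x
  ord-just⇒≤∞ x ex = subst (_ ≤∞_) (sym ex) ℤ.≤-refl

  ord-*-≤∞ : ∀ {k l} x y → k ≤∞ ord p x → l ≤∞ ord p y → k ℤ.+ l ≤∞ ord p (x ℚ.* y)
  ord-*-≤∞ x y k≤x l≤y = subst (_ ≤∞_) (sym (ord-* x y)) (≤∞-+∞ (ord p x) (ord p y) k≤x l≤y)

  ord-*-just : ∀ {e f} x y → ord p x ≡ just e → ord p y ≡ just f → ord p (x ℚ.* y) ≡ just (e ℤ.+ f)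
  ord-*-just x y ex ey = trans (ord-* x y) (cong₂ _+∞_ ex ey)

  ord-neg-≤∞ : ∀ {k} x → k ≤∞ ord p x → k ≤∞ ord p (ℚ.- x)
  ord-neg-≤∞ x k≤x = subst (_ ≤∞_) (sym (ord-neg x)) k≤x

  ord-−-≤∞ : ∀ {k} x y → k ≤∞ ord p x → k ≤∞ ord p y → k ≤∞ ord p (x ℚ.- y)
  ord-−-≤∞ x y k≤x k≤y = ord-+ x (ℚ.- y) k≤x (ord-neg-≤∞ y k≤y)

  ord-*-cancelˡ : ∀ {e m} x y → ord p x ≡ just e → m ≤∞ ord p (x ℚ.* y) → m ℤ.- e ≤∞ ord p y
  ord-*-cancelˡ {e} {m} x y ex m≤xy =
    cancel (ord p y) (subst (m ≤∞_) (trans (ord-* x y) (cong (_+∞ ord p y) ex)) m≤xy)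
    where
    cancel : ∀ o → m ≤∞ just e +∞ o → m ℤ.- e ≤∞ o
    cancel nothing  _       = tt
    cancel (just f) m≤e+f = subst (m ℤ.- e ℤ.≤_) (plus-minus e f) (ℤ.+-monoˡ-≤ (ℤ.- e) m≤e+f)
      where
      plus-minus : ∀ e f → e ℤ.+ f ℤ.- e ≡ f
      plus-minus = solve-∀

  ord-+-dominantˡ : ∀ {e} x y → ord p x ≡ just e → ℤ.suc e ≤∞ ord p y → ord p (x ℚ.+ y) ≡ just e
  ord-+-dominantˡ {e} x y ex e<y = ≤∞-exact (ord p (x ℚ.+ y))
    (ord-+ x y (ord-just⇒≤∞ x ex) (≤∞-trans (ord p y) (ℤ.i≤suc[i] e) e<y))
    λ e<x+y → suc[i]≰i e
      (subst (ℤ.suc e ≤∞_) (trans (cong (ord p) (cancel x y)) ex) (ord-−-≤∞ (x ℚ.+ y) y e<x+y e<y))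
    where
    cancel : ∀ x y → x ℚ.+ y ℚ.- y ≡ x
    cancel = +-*-Solver.solve 2 (λ x y → x :+ y :- y := x) refl
      where open +-*-Solver

  ord-−-dominantˡ : ∀ {e} x y → ord p x ≡ just e → ℤ.suc e ≤∞ ord p y → ord p (x ℚ.- y) ≡ just e
  ord-−-dominantˡ x y ex e<y = ord-+-dominantˡ x (ℚ.- y) ex (ord-neg-≤∞ y e<y)

  ord-−-dominantʳ : ∀ {e} x y → ℤ.suc e ≤∞ ord p x → ord p y ≡ just e → ord p (x ℚ.- y) ≡ just e
  ord-−-dominantʳ x y e<x ey =
    trans (cong (ord p) (ℚ.+-comm x (ℚ.- y))) (ord-+-dominantˡ (ℚ.- y) x (trans (ord-neg y) ey) e<x)

  ord-cube-≤∞ : ∀ {k} x → k ≤∞ ord p x → + 3 ℤ.* k ≤∞ ord p (x ℚ.* x ℚ.* x)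
  ord-cube-≤∞ {k} x k≤x =
    subst (_≤∞ _) (k+k+k≡3k k) (ord-*-≤∞ (x ℚ.* x) x (ord-*-≤∞ x x k≤x k≤x) k≤x)

  ord-cube-just : ∀ {v} x → ord p x ≡ just v → ord p (x ℚ.* x ℚ.* x) ≡ just (+ 3 ℤ.* v)
  ord-cube-just {v} x ex = trans (ord-*-just (x ℚ.* x) x (ord-*-just x x ex ex) ex) (cong just (k+k+k≡3k v))

  private
    drop-vℕ-1 : ∀ n → just (+ vℕ p n ℤ.- + vℕ p 1) ≡ just (+ vℕ p n)
    drop-vℕ-1 n = cong just (trans (cong (λ v → + vℕ p n ℤ.- + v) (vℕ-1 1<p)) (ℤ.+-identityʳ _))

  ord-2 : ord p (+ 2 ℚ./ 1) ≡ just (+ vℕ p 2)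
  ord-2 = drop-vℕ-1 2

  ord-4 : ord p (+ 4 ℚ./ 1) ≡ just (+ vℕ p 4)
  ord-4 = drop-vℕ-1 4

  ord-6 : ord p (+ 6 ℚ./ 1) ≡ just (+ vℕ p 6)
  ord-6 = drop-vℕ-1 6

  ord≡+⇒0≤∞ : ∀ {n} x → ord p x ≡ just (+ n) → + 0 ≤∞ ord p x
  ord≡+⇒0≤∞ x ex = subst (+ 0 ≤∞_) (sym ex) (ℤ.+≤+ ℕ.z≤n)

-- The morphism φ

private
  3k+k≡4k : ∀ k → + 3 ℤ.* k ℤ.+ k ≡ + 4 ℤ.* k
  3k+k≡4k = solve-∀
  0+k+3k≡4k : ∀ k → + 0 ℤ.+ k ℤ.+ + 3 ℤ.* k ≡ + 4 ℤ.* k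
  0+k+3k≡4k = solve-∀
  3k+3k≡6k : ∀ k → + 3 ℤ.* k ℤ.+ + 3 ℤ.* k ≡ + 6 ℤ.* k
  3k+3k≡6k = solve-∀
  0+3k+3k≡6k : ∀ k → + 0 ℤ.+ + 3 ℤ.* k ℤ.+ + 3 ℤ.* k ≡ + 6 ℤ.* k
  0+3k+3k≡6k = solve-∀
  0+[3k+3k]≡6k : ∀ k → + 0 ℤ.+ (+ 3 ℤ.* k ℤ.+ + 3 ℤ.* k) ≡ + 6 ℤ.* k
  0+[3k+3k]≡6k = solve-∀
  v+[0+[1+3v]]≡1+4v : ∀ v → v ℤ.+ (+ 0 ℤ.+ (+ 1 ℤ.+ + 3 ℤ.* v)) ≡ + 1 ℤ.+ + 4 ℤ.* v
  v+[0+[1+3v]]≡1+4v = solve-∀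
  1+[1+2u]≡[1+u]+[1+u] : ∀ u → + 1 ℤ.+ (+ 1 ℤ.+ (u ℤ.+ u)) ≡ (+ 1 ℤ.+ u) ℤ.+ (+ 1 ℤ.+ u)
  1+[1+2u]≡[1+u]+[1+u] = solve-∀
  o+[1+u]+u≡1+[o+2u] : ∀ o u → o ℤ.+ (+ 1 ℤ.+ u) ℤ.+ u ≡ + 1 ℤ.+ (o ℤ.+ (u ℤ.+ u))
  o+[1+u]+u≡1+[o+2u] = solve-∀
  1+[o+2u]≡[1+u]+[o+u] : ∀ o u → + 1 ℤ.+ (o ℤ.+ (u ℤ.+ u)) ≡ (+ 1 ℤ.+ u) ℤ.+ (o ℤ.+ u)
  1+[o+2u]≡[1+u]+[o+u] = solve-∀

o+2u<6k : ∀ {o u k} → o ℤ.≤ + 1 → u ℤ.< + 3 ℤ.* k → o ℤ.+ (u ℤ.+ u) ℤ.< + 6 ℤ.* k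
o+2u<6k {o} {u} {k} o≤1 u<3k = begin-strict
  o ℤ.+ (u ℤ.+ u)                    ≤⟨ ℤ.+-monoˡ-≤ (u ℤ.+ u) o≤1 ⟩
  + 1 ℤ.+ (u ℤ.+ u)                  <⟨ ℤ.+-monoˡ-< (u ℤ.+ u) (ℤ.+<+ (ℕ.n<1+n 1)) ⟩
  + 2 ℤ.+ (u ℤ.+ u)                  ≡⟨ 2+[u+u]≡[1+u]+[1+u] u ⟩
  ℤ.suc u ℤ.+ ℤ.suc u                ≤⟨ ℤ.+-mono-≤ 1+u≤3k 1+u≤3k ⟩
  + 3 ℤ.* k ℤ.+ + 3 ℤ.* k            ≡⟨ 3k+3k≡6k k ⟩
  + 6 ℤ.* k                          ∎
  where
  open ℤ.≤-Reasoning
  1+u≤3k : ℤ.suc u ℤ.≤ + 3 ℤ.* k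
  1+u≤3k = ℤ.i<j⇒suc[i]≤j u<3k
  2+[u+u]≡[1+u]+[1+u] : ∀ u → + 2 ℤ.+ (u ℤ.+ u) ≡ (+ 1 ℤ.+ u) ℤ.+ (+ 1 ℤ.+ u)
  2+[u+u]≡[1+u]+[1+u] = solve-∀

1+u≤4k-v : ∀ {u v k} → v ℤ.< k → u ℤ.≤ + 3 ℤ.* v → ℤ.suc u ℤ.≤ + 4 ℤ.* k ℤ.- v
1+u≤4k-v {u} {v} {k} v<k u≤3v = begin
  ℤ.suc u                            ≡⟨ i≡i+v-v (ℤ.suc u) v ⟩
  ℤ.suc u ℤ.+ v ℤ.- v                ≤⟨ ℤ.+-monoˡ-≤ (ℤ.- v) 1+u+v≤4k ⟩
  + 4 ℤ.* k ℤ.- v                    ∎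
  where
  open ℤ.≤-Reasoning
  i≡i+v-v : ∀ i v → i ≡ i ℤ.+ v ℤ.- v
  i≡i+v-v = solve-∀
  [1+3v]+v≡1+4v : ∀ v → (+ 1 ℤ.+ + 3 ℤ.* v) ℤ.+ v ≡ + 1 ℤ.+ + 4 ℤ.* v
  [1+3v]+v≡1+4v = solve-∀
  1+u+v≤4k : ℤ.suc u ℤ.+ v ℤ.≤ + 4 ℤ.* k
  1+u+v≤4k = begin
    ℤ.suc u ℤ.+ v                    ≤⟨ ℤ.+-monoˡ-≤ v (ℤ.suc-mono u≤3v) ⟩
    ℤ.suc (+ 3 ℤ.* v) ℤ.+ v          ≡⟨ [1+3v]+v≡1+4v v ⟩
    ℤ.suc (+ 4 ℤ.* v)                ≤⟨ ℤ.i<j⇒suc[i]≤j (ℤ.*-monoˡ-<-pos (+ 4) v<k) ⟩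
    + 4 ℤ.* k                        ∎

c₂ c₄ c₆ : ℚ
c₂ = + 2 ℚ./ 1
c₄ = + 4 ℚ./ 1
c₆ = + 6 ℚ./ 1

module _ (a b : ℚ) where

  -- φ a b reduces to φ₁ ∷ φ₂ ∷ [].
  a³ φ₁ φ₂ A′ : ℚ
  a³ = a ℚ.* a ℚ.* a
  φ₁ = a ℚ.* a ℚ.* a ℚ.* a ℚ.- c₄ ℚ.* a ℚ.* b
  φ₂ = ℚ.- (a ℚ.* a ℚ.* a ℚ.* a ℚ.* a ℚ.* a) ℚ.+ c₆ ℚ.* a³ ℚ.* b ℚ.- c₆ ℚ.* (b ℚ.* b)
  A′ = a³ ℚ.- c₄ ℚ.* b

  private
    open +-*-Solver

    c₄ab≡ : c₄ ℚ.* a ℚ.* b ≡ a ℚ.* (c₄ ℚ.* b)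
    c₄ab≡ = solve 2 (λ x y → con c₄ :* x :* y := x :* (con c₄ :* y)) refl a b

    a⁶≡a³a³ : a ℚ.* a ℚ.* a ℚ.* a ℚ.* a ℚ.* a ≡ a³ ℚ.* a³
    a⁶≡a³a³ = solve 1 (λ x → x :* x :* x :* x :* x :* x := (x :* x :* x) :* (x :* x :* x)) refl a

    φ₁≡aA′ : φ₁ ≡ a ℚ.* A′
    φ₁≡aA′ = solve 2 (λ x y → x :* x :* x :* x :- con c₄ :* x :* y := x :* (x :* x :* x :- con c₄ :* y))
               refl a b

    φ₂≡c₂b²-A′[A′+c₂b] : φ₂ ≡ c₂ ℚ.* (b ℚ.* b) ℚ.- A′ ℚ.* (A′ ℚ.+ c₂ ℚ.* b)
    φ₂≡c₂b²-A′[A′+c₂b] = solve 2 (λ x y →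
        :- (x :* x :* x :* x :* x :* x) :+ con c₆ :* (x :* x :* x) :* y :- con c₆ :* (y :* y)
        := con c₂ :* (y :* y) :- (x :* x :* x :- con c₄ :* y) :* ((x :* x :* x :- con c₄ :* y) :+ con c₂ :* y))
      refl a b

  module _ {p : ℕ} (prime : Prime p) where

    private instance
      p≢0 : NonZero p
      p≢0 = prime⇒nonZero prime

    φ-bounds⁺ : ∀ {k} → k ≤∞ ord p a → + 3 ℤ.* k ≤∞ ord p b →
                + 4 ℤ.* k ≤∞ ord p φ₁ × + 6 ℤ.* k ≤∞ ord p φ₂
    φ-bounds⁺ {k} k≤a 3k≤b =
        ord-−-≤∞ prime _ _ a⁴-bound c₄ab-bound
      , ord-−-≤∞ prime _ _ (ord-+ prime _ _ (ord-neg-≤∞ prime _ a⁶-bound) c₆a³b-bound) c₆b²-bound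
      where
      3k≤a³ : + 3 ℤ.* k ≤∞ ord p a³
      3k≤a³ = ord-cube-≤∞ prime a k≤a
      0≤c₄ : + 0 ≤∞ ord p c₄
      0≤c₄ = ord≡+⇒0≤∞ prime c₄ (ord-4 prime)
      0≤c₆ : + 0 ≤∞ ord p c₆
      0≤c₆ = ord≡+⇒0≤∞ prime c₆ (ord-6 prime)
      a⁴-bound : + 4 ℤ.* k ≤∞ ord p (a³ ℚ.* a)
      a⁴-bound = subst (_≤∞ _) (3k+k≡4k k) (ord-*-≤∞ prime a³ a 3k≤a³ k≤a)
      c₄ab-bound : + 4 ℤ.* k ≤∞ ord p (c₄ ℚ.* a ℚ.* b)
      c₄ab-bound = subst (_≤∞ _) (0+k+3k≡4k k)
        (ord-*-≤∞ prime (c₄ ℚ.* a) b (ord-*-≤∞ prime c₄ a 0≤c₄ k≤a) 3k≤b)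
      a⁶-bound : + 6 ℤ.* k ≤∞ ord p (a ℚ.* a ℚ.* a ℚ.* a ℚ.* a ℚ.* a)
      a⁶-bound = subst₂ _≤∞_ (3k+3k≡6k k) (cong (ord p) (sym a⁶≡a³a³))
        (ord-*-≤∞ prime a³ a³ 3k≤a³ 3k≤a³)
      c₆a³b-bound : + 6 ℤ.* k ≤∞ ord p (c₆ ℚ.* a³ ℚ.* b)
      c₆a³b-bound = subst (_≤∞ _) (0+3k+3k≡6k k)
        (ord-*-≤∞ prime (c₆ ℚ.* a³) b (ord-*-≤∞ prime c₆ a³ 0≤c₆ 3k≤a³) 3k≤b)
      c₆b²-bound : + 6 ℤ.* k ≤∞ ord p (c₆ ℚ.* (b ℚ.* b))
      c₆b²-bound = subst (_≤∞ _) (0+[3k+3k]≡6k k)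
        (ord-*-≤∞ prime c₆ (b ℚ.* b) 0≤c₆ (ord-*-≤∞ prime b b 3k≤b 3k≤b))

    a⁴-dominates-φ₁ : ∀ {v k} → ord p a ≡ just v → v ℤ.< k → ℤ.suc (+ 3 ℤ.* v) ≤∞ ord p b →
                      ¬ + 4 ℤ.* k ≤∞ ord p φ₁
    a⁴-dominates-φ₁ {v} {k} ea v<k 3v<b 4k≤φ₁ =
      ℤ.<⇒≱ (ℤ.*-monoˡ-<-pos (+ 4) v<k) (subst (_ ≤∞_) eφ₁ 4k≤φ₁)
      where
      ea⁴ : ord p (a³ ℚ.* a) ≡ just (+ 4 ℤ.* v)
      ea⁴ = trans (ord-*-just prime a³ a (ord-cube-just prime a ea) ea) (cong just (3k+k≡4k v))
      4v<c₄ab : ℤ.suc (+ 4 ℤ.* v) ≤∞ ord p (c₄ ℚ.* a ℚ.* b)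
      4v<c₄ab = subst₂ _≤∞_ (v+[0+[1+3v]]≡1+4v v) (cong (ord p) (sym c₄ab≡))
        (ord-*-≤∞ prime a (c₄ ℚ.* b) (ord-just⇒≤∞ prime a ea)
          (ord-*-≤∞ prime c₄ b (ord≡+⇒0≤∞ prime c₄ (ord-4 prime)) 3v<b))
      eφ₁ : ord p φ₁ ≡ just (+ 4 ℤ.* v)
      eφ₁ = ord-−-dominantˡ prime (a³ ℚ.* a) _ ea⁴ 4v<c₄ab

    c₆b²-dominates-φ₂ : ∀ {u k} → ord p b ≡ just u → u ℤ.< + 3 ℤ.* k → ℤ.suc u ≤∞ ord p a³ →
                        ¬ + 6 ℤ.* k ≤∞ ord p φ₂
    c₆b²-dominates-φ₂ {u} {k} eb u<3k u<a³ 6k≤φ₂ =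
      ℤ.<⇒≱ (o+2u<6k o₆≤1 u<3k) (subst (_ ≤∞_) eφ₂ 6k≤φ₂)
      where
      o₆ = + vℕ p 6
      o₆≤1 : o₆ ℤ.≤ + 1
      o₆≤1 = ℤ.+≤+ (vℕ-≤1 (1<p prime) 6 (p²∤6 (1<p prime)))
      ec₆b² : ord p (c₆ ℚ.* (b ℚ.* b)) ≡ just (o₆ ℤ.+ (u ℤ.+ u))
      ec₆b² = ord-*-just prime c₆ (b ℚ.* b) (ord-6 prime) (ord-*-just prime b b eb eb)
      1+o₆+2u≤[1+u]+[1+u] : ℤ.suc (o₆ ℤ.+ (u ℤ.+ u)) ℤ.≤ ℤ.suc u ℤ.+ ℤ.suc u
      1+o₆+2u≤[1+u]+[1+u] = ℤ.≤-trans (ℤ.+-monoʳ-≤ (+ 1) (ℤ.+-monoˡ-≤ (u ℤ.+ u) o₆≤1))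
                                      (ℤ.≤-reflexive (1+[1+2u]≡[1+u]+[1+u] u))
      a⁶-bound : ℤ.suc (o₆ ℤ.+ (u ℤ.+ u)) ≤∞ ord p (a ℚ.* a ℚ.* a ℚ.* a ℚ.* a ℚ.* a)
      a⁶-bound = subst (_ ≤∞_) (cong (ord p) (sym a⁶≡a³a³))
        (≤∞-trans (ord p (a³ ℚ.* a³)) 1+o₆+2u≤[1+u]+[1+u] (ord-*-≤∞ prime a³ a³ u<a³ u<a³))
      c₆a³b-bound : ℤ.suc (o₆ ℤ.+ (u ℤ.+ u)) ≤∞ ord p (c₆ ℚ.* a³ ℚ.* b)
      c₆a³b-bound = subst (_≤∞ _) (o+[1+u]+u≡1+[o+2u] o₆ u)
        (ord-*-≤∞ prime (c₆ ℚ.* a³) b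
          (ord-*-≤∞ prime c₆ a³ (ord-just⇒≤∞ prime c₆ (ord-6 prime)) u<a³)
          (ord-just⇒≤∞ prime b eb))
      eφ₂ : ord p φ₂ ≡ just (o₆ ℤ.+ (u ℤ.+ u))
      eφ₂ = ord-−-dominantʳ prime _ _
        (ord-+ prime _ _ (ord-neg-≤∞ prime _ a⁶-bound) c₆a³b-bound) ec₆b²

    c₂b²-dominates-φ₂ : ∀ {v u k} → ord p a ≡ just v → ord p b ≡ just u →
                        v ℤ.< k → u ℤ.≤ + 3 ℤ.* v →
                        + 4 ℤ.* k ≤∞ ord p φ₁ → ¬ + 6 ℤ.* k ≤∞ ord p φ₂
    c₂b²-dominates-φ₂ {v} {u} {k} ea eb v<k u≤3v 4k≤φ₁ 6k≤φ₂ =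
      ℤ.<⇒≱ (o+2u<6k o₂≤1 u<3k) (subst (_ ≤∞_) eφ₂ 6k≤φ₂)
      where
      o₂ = + vℕ p 2
      o₂≤1 : o₂ ℤ.≤ + 1
      o₂≤1 = ℤ.+≤+ (vℕ-≤1 (1<p prime) 2 (p²∤2 (1<p prime)))
      u<3k : u ℤ.< + 3 ℤ.* k
      u<3k = ℤ.≤-<-trans u≤3v (ℤ.*-monoˡ-<-pos (+ 3) v<k)
      A′-bound : + 4 ℤ.* k ℤ.- v ≤∞ ord p A′
      A′-bound = ord-*-cancelˡ prime a A′ ea (subst (_ ≤∞_) (cong (ord p) φ₁≡aA′) 4k≤φ₁)
      ec₂b : ord p (c₂ ℚ.* b) ≡ just (o₂ ℤ.+ u)
      ec₂b = ord-*-just prime c₂ b (ord-2 prime) eb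
      o₂+u≤4k-v : o₂ ℤ.+ u ℤ.≤ + 4 ℤ.* k ℤ.- v
      o₂+u≤4k-v = ℤ.≤-trans (ℤ.+-monoˡ-≤ u o₂≤1) (1+u≤4k-v v<k u≤3v)
      A′+c₂b-bound : o₂ ℤ.+ u ≤∞ ord p (A′ ℚ.+ c₂ ℚ.* b)
      A′+c₂b-bound = ord-+ prime A′ (c₂ ℚ.* b)
        (≤∞-trans (ord p A′) o₂+u≤4k-v A′-bound) (ord-just⇒≤∞ prime _ ec₂b)
      1+o₂+2u≤4k-v+o₂+u : ℤ.suc (o₂ ℤ.+ (u ℤ.+ u)) ℤ.≤ (+ 4 ℤ.* k ℤ.- v) ℤ.+ (o₂ ℤ.+ u)
      1+o₂+2u≤4k-v+o₂+u = ℤ.≤-trans (ℤ.≤-reflexive (1+[o+2u]≡[1+u]+[o+u] o₂ u))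
                                    (ℤ.+-monoˡ-≤ (o₂ ℤ.+ u) (1+u≤4k-v v<k u≤3v))
      A′[A′+c₂b]-bound : ℤ.suc (o₂ ℤ.+ (u ℤ.+ u)) ≤∞ ord p (A′ ℚ.* (A′ ℚ.+ c₂ ℚ.* b))
      A′[A′+c₂b]-bound = ≤∞-trans (ord p (A′ ℚ.* (A′ ℚ.+ c₂ ℚ.* b))) 1+o₂+2u≤4k-v+o₂+u
        (ord-*-≤∞ prime A′ _ A′-bound A′+c₂b-bound)
      ec₂b² : ord p (c₂ ℚ.* (b ℚ.* b)) ≡ just (o₂ ℤ.+ (u ℤ.+ u))
      ec₂b² = ord-*-just prime c₂ (b ℚ.* b) (ord-2 prime) (ord-*-just prime b b eb eb)
      eφ₂ : ord p φ₂ ≡ just (o₂ ℤ.+ (u ℤ.+ u))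
      eφ₂ = trans (cong (ord p) φ₂≡c₂b²-A′[A′+c₂b])
        (ord-−-dominantˡ prime _ _ ec₂b² A′[A′+c₂b]-bound)

    φ-bounds⁻ : ∀ {k} → + 4 ℤ.* k ≤∞ ord p φ₁ → + 6 ℤ.* k ≤∞ ord p φ₂ →
                k ≤∞ ord p a × + 3 ℤ.* k ≤∞ ord p b
    φ-bounds⁻ {k} 4k≤φ₁ 6k≤φ₂ with ≤∞-dec k (ord p a) | ≤∞-dec (+ 3 ℤ.* k) (ord p b)
    ... | yes k≤a | yes 3k≤b = k≤a , 3k≤b
    ... | yes k≤a | no  3k≰b =
      let u , eb , u<3k = ≰∞⇒finite (ord p b) 3k≰b
          u<a³ = ≤∞-trans (ord p a³) (ℤ.i<j⇒suc[i]≤j u<3k) (ord-cube-≤∞ prime a k≤a)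
      in contradiction 6k≤φ₂ (c₆b²-dominates-φ₂ eb u<3k u<a³)
    ... | no  k≰a | _ with ≰∞⇒finite (ord p a) k≰a
    ... | v , ea , v<k with ≤∞-dec (ℤ.suc (+ 3 ℤ.* v)) (ord p b)
    ... | yes 3v<b = contradiction 4k≤φ₁ (a⁴-dominates-φ₁ ea v<k 3v<b)
    ... | no  3v≮b =
      let u , eb , u<1+3v = ≰∞⇒finite (ord p b) 3v≮b
      in contradiction 6k≤φ₂ (c₂b²-dominates-φ₂ ea eb v<k (i<suc[j]⇒i≤j u<1+3v) 4k≤φ₁)

    φ-bounds⇔ : ∀ k → Pointwise (ScaledBound p k) (4 ∷ 6 ∷ []) (φ a b)
                    ⇔ Pointwise (ScaledBound p k) (1 ∷ 3 ∷ []) (a ∷ b ∷ [])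
    φ-bounds⇔ k = mk⇔
      (λ { (4k≤φ₁ ∷ 6k≤φ₂ ∷ []) → let k≤a , 3k≤b = φ-bounds⁻ 4k≤φ₁ 6k≤φ₂
                                  in subst (_≤∞ _) (sym 1k≡k) k≤a ∷ 3k≤b ∷ [] })
      (λ { (1k≤a ∷ 3k≤b ∷ []) → let 4k≤φ₁ , 6k≤φ₂ = φ-bounds⁺ (subst (_≤∞ _) 1k≡k 1k≤a) 3k≤b
                                in 4k≤φ₁ ∷ 6k≤φ₂ ∷ [] })
      where
      1k≡k : + 1 ℤ.* k ≡ k
      1k≡k = ℤ.*-identityˡ k

-- At a = b = 0 both sides are ∞.
lemma4p9 : (a b : ℚ) → ¬ (a ≡ 0ℚ × b ≡ 0ℚ) →
    (p : ℕ) → (pp : Prime p) →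
    scalingExp (4 ∷ 6 ∷ []) (φ a b) p {{prime⇒nonZero pp}}
      ≡ scalingExp (1 ∷ 3 ∷ []) (a ∷ b ∷ []) p {{prime⇒nonZero pp}}
lemma4p9 a b _ p pp =
  scalingExp-cong p {{prime⇒nonZero pp}} (4 ∷ 6 ∷ []) (φ a b) (1 ∷ 3 ∷ []) (a ∷ b ∷ [])
    (_ ∷ _ ∷ []) (_ ∷ _ ∷ []) (φ-bounds⇔ a b pp)
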